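{- For all integers $n\ge 1$ and $1\le i\le n$, $$d_{n,i}^B(x)=d_{n,i-1}^B(x)+d_{n-1,i-1}^B(x).$$
   Context: $B_n$ is the group of signed permutations $\sigma$ of $\pm[n]=\{\pm1,\dots,\pm n\}$ with $\sigma(-i)=-\sigma(i)$, written $\sigma=\sigma(1)\cdots\sigma(n)$; write $\overline{i}=-i$. For $\sigma\in B_n$, an index $i\in[n]$ is an excedance of $\sigma$ if $\sigma(|\sigma(i)|)>\sigma(i)$, and a fixed point if $\sigma(i)=i$; ${\rm exc}(\sigma)$ denotes the number of excedances. A type $B$ derangement is a $\sigma\in B_n$ with no fixed points. For $1\le i\le n$, $\widetilde{\mathcal D}^B_{n,i}$ is the set of type $B$ derangements $\sigma\in B_n$ whose set of negative entries $\{\sigma(k):k\in[n],\ \sigma(k)<0\}$ equals $\{\overline{n},\overline{n-1},\dots,\overline{n-i+1}\}$, and $d^B_{n,i}(x)=\sum_{\sigma\in\widetilde{\mathcal D}^B_{n,i}}x^{{\rm exc}(\sigma)}$. Also $d^B_{n,0}(x)=d_n(x)$, where $d_n(x)=\sum_{\pi}x^{{\rm exc}(\pi)}$ is summed over derangements $\pi$ of $[n]$ (permutations with no $\pi(k)=k$), ${\rm exc}(\pi)=\#\{k:\pi(k)>k\}$, and $d_0(x)=1$. -}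

module Defs where

open import Data.Nat as ℕ using (ℕ; zero; suc; _∸_)
open import Data.Integer as ℤ using (ℤ; +_; -_; ∣_∣)
open import Data.List using (List; []; _∷_; _++_; map; concatMap; filterᵇ; length; upTo)
open import Data.Bool.ListAction using (all; any)
open import Data.Vec using (Vec; []; _∷_)
open import Data.Bool using (Bool; true; false; _∧_; _∨_; not; if_then_else_)
open import Relation.Nullary.Decidable using (⌊_⌋)

[_] : ℕ → List ℕ
[ n ] = map suc (upTo n)

vecsOver : {A : Set} → List A → (n : ℕ) → List (Vec A n)
vecsOver L zero    = [] ∷ []
vecsOver L (suc n) = concatMap (λ a → map (a ∷_) (vecsOver L n)) L

-- 1-based lookup: at v k = v(k) for k ∈ [n]; default value outside.
at : {A : Set} {n : ℕ} → A → Vec A n → ℕ → A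
at d []      _             = d
at d (x ∷ v) zero          = d
at d (x ∷ v) (suc zero)    = x
at d (x ∷ v) (suc (suc k)) = at d v (suc k)

count : {A : Set} → (A → Bool) → List A → ℕ
count p xs = length (filterᵇ p xs)

π⟨_⟩ : {n : ℕ} → Vec ℕ n → ℕ → ℕ
π⟨ π ⟩ = at 0 π

isPerm : {n : ℕ} → Vec ℕ n → Bool
isPerm {n} π =
  all (λ k → any (λ j → ⌊ π⟨ π ⟩ k ℕ.≟ j ⌋) [ n ]) [ n ]
  ∧ all (λ k → all (λ l → ⌊ k ℕ.≟ l ⌋ ∨ not ⌊ π⟨ π ⟩ k ℕ.≟ π⟨ π ⟩ l ⌋) [ n ]) [ n ]

isDerangement : {n : ℕ} → Vec ℕ n → Bool
isDerangement {n} π = isPerm π ∧ all (λ k → not ⌊ π⟨ π ⟩ k ℕ.≟ k ⌋) [ n ]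

exc : {n : ℕ} → Vec ℕ n → ℕ
exc {n} π = count (λ k → ⌊ k ℕ.<? π⟨ π ⟩ k ⌋) [ n ]

-- coefficient of x^e in d_n(x)
dCoeff : ℕ → ℕ → ℕ
dCoeff n e = count (λ π → isDerangement π ∧ ⌊ exc π ℕ.≟ e ⌋) (vecsOver [ n ] n)

-- Signed permutations σ ∈ B_n, written σ = σ(1)⋯σ(n) with σ(-i) = -σ(i)

±[_] : ℕ → List ℤ
±[ n ] = map (λ k → - (+ k)) [ n ] ++ map +_ [ n ]

σ⟨_⟩ : {n : ℕ} → Vec ℤ n → ℕ → ℤ
σ⟨ σ ⟩ = at (+ 0) σ

-- σ is a bijection of ±[n] (with σ(-i) = -σ(i)): entries in ±[n] and
-- k ↦ |σ(k)| is injective on [n]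
isSignedPerm : {n : ℕ} → Vec ℤ n → Bool
isSignedPerm {n} σ =
  all (λ k → any (λ v → ⌊ σ⟨ σ ⟩ k ℤ.≟ v ⌋) ±[ n ]) [ n ]
  ∧ all (λ k → all (λ l → ⌊ k ℕ.≟ l ⌋ ∨ not ⌊ ∣ σ⟨ σ ⟩ k ∣ ℕ.≟ ∣ σ⟨ σ ⟩ l ∣ ⌋) [ n ]) [ n ]

excB : {n : ℕ} → Vec ℤ n → ℕ
excB {n} σ = count (λ i → ⌊ σ⟨ σ ⟩ i ℤ.<? σ⟨ σ ⟩ ∣ σ⟨ σ ⟩ i ∣ ⌋) [ n ]

isDerangementB : {n : ℕ} → Vec ℤ n → Bool
isDerangementB {n} σ = isSignedPerm σ ∧ all (λ i → not ⌊ σ⟨ σ ⟩ i ℤ.≟ + i ⌋) [ n ]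

-- the set of negative entries {σ(k) : k ∈ [n], σ(k) < 0} equals
-- {-n, -(n-1), ..., -(n-i+1)}  (both inclusions)
negTarget : ℕ → ℕ → List ℤ
negTarget n i = map (λ t → - (+ (n ∸ t))) (upTo i)

negSetIs : {n : ℕ} → ℕ → Vec ℤ n → Bool
negSetIs {n} i σ =
  all (λ k → not ⌊ σ⟨ σ ⟩ k ℤ.<? + 0 ⌋ ∨ any (λ v → ⌊ σ⟨ σ ⟩ k ℤ.≟ v ⌋) (negTarget n i)) [ n ]
  ∧ all (λ v → any (λ k → ⌊ σ⟨ σ ⟩ k ℤ.≟ v ⌋ ∧ ⌊ σ⟨ σ ⟩ k ℤ.<? + 0 ⌋) [ n ]) (negTarget n i)

-- coefficient of x^e in d^B_{n,i}(x); for i = 0 it is d_n(x)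
dBCoeff : ℕ → ℕ → ℕ → ℕ
dBCoeff n zero    e = dCoeff n e
dBCoeff n (suc i) e =
  count (λ σ → isDerangementB σ ∧ negSetIs (suc i) σ ∧ ⌊ excB σ ℕ.≟ e ⌋) (vecsOver ±[ n ] n)

-- Write D(n, a) for the excedance polynomial of the permutations of [n] with no fixed point
-- larger than a, so that D(n, 0) = d_n(x). For 0 < i ≤ n, relabel values by the order-preserving
-- bijection  -n < ⋯ < -(n-i+1) < 1 < ⋯ < n-i  ↦  1 < ⋯ < n  and conjugate |σ| by it. Since a type B
-- excedance compares the values σ(k) and σ(|σ(k)|), excedances are preserved, and the fixed points
-- of σ become fixed points larger than i; this bijection gives d^B_{n,i} = D(n, i) for 0 ≤ i ≤ n.
-- Finally D(n, i) = D(n, i-1) + D(n-1, i-1): the permutations counted by D(n, i) but not by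
-- D(n, i-1) are those fixing i, and deleting that fixed point (and standardizing) is an
-- excedance-preserving bijection onto the permutations counted by D(n-1, i-1).

module Submission where

open import Defs
open import Data.Nat using (ℕ; _≤_; _∸_; _+_)
open import Relation.Binary.PropositionalEquality using (_≡_)

open import Data.Bool using (Bool; true; false; T; _∧_; _∨_; not)
open import Data.Bool.Properties using (T-∧; ∨-comm; ∧-assoc)
open import Data.Bool.ListAction using (all; any)
open import Data.Empty using (⊥-elim)
open import Data.Integer as ℤ using (ℤ; +_; -_; ∣_∣; +<+; -<+; -<-)
import Data.Integer.Properties as ℤ
open import Data.List using (List; []; _∷_; _++_; map; concatMap; filterᵇ; length; upTo)
import Data.List.Properties as List
open import Data.List.Membership.Propositional using (_∈_; find; lose)
open import Data.List.Membership.Propositional.Properties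
open import Data.List.Relation.Unary.All.Properties using (all⁺; all⁻)
import Data.List.Relation.Unary.All as All
open import Data.List.Relation.Unary.AllPairs using ([]; _∷_)
open import Data.List.Relation.Unary.Any using (here; there)
import Data.List.Relation.Unary.Any as Any
open import Data.List.Relation.Unary.Any.Properties using (any⁺; any⁻)
open import Data.List.Relation.Unary.Unique.Propositional using (Unique)
import Data.List.Relation.Unary.Unique.Propositional.Properties as Unique
open import Data.Nat using (zero; suc; pred; _<_; z≤n; s≤s; _≤?_; _<?_; _≟_)
open import Data.Nat.Properties
open import Data.List.Membership.DecPropositional _≟_ using (_∈?_)
open import Data.Product using (∃; _×_; _,_; proj₁; proj₂)
open import Data.Sum using (_⊎_; inj₁; inj₂)
open import Data.Vec using (Vec; []; _∷_)
open import Function using (_∘_; _⇔_; mk⇔; Equivalence)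
open import Relation.Binary using (DecidableEquality; tri<; tri≈; tri>)
open import Relation.Binary.PropositionalEquality using (refl; sym; trans; cong; cong₂; subst; _≢_; module ≡-Reasoning)
open import Relation.Nullary using (¬_; Dec; yes; no)
open import Relation.Nullary.Decidable
  using (⌊_⌋; toWitness; fromWitness; toWitnessFalse; fromWitnessFalse; dec-false; isYes≗does)

open Equivalence using (to; from)

private variable
  A B : Set

module _ {p q : A → Bool} where

  count-cong : (xs : List A) → (∀ {x} → x ∈ xs → p x ≡ q x) → count p xs ≡ count q xs
  count-cong []       _   = refl
  count-cong (x ∷ xs) p≗q with p x | q x | p≗q (here refl) | count-cong xs (p≗q ∘ there)
  ... | true  | true  | _ | ih = cong suc ih
  ... | false | false | _ | ih = ih

  all-cong : (xs : List A) → (∀ {x} → x ∈ xs → p x ≡ q x) → all p xs ≡ all q xs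
  all-cong []       _   = refl
  all-cong (x ∷ xs) p≗q = cong₂ _∧_ (p≗q (here refl)) (all-cong xs (p≗q ∘ there))

  count-split : (xs : List A) → count p xs ≡ count (λ x → p x ∧ q x) xs + count (λ x → p x ∧ not (q x)) xs
  count-split []       = refl
  count-split (x ∷ xs) with p x | q x | count-split xs
  ... | false | _     | ih = ih
  ... | true  | true  | ih = cong suc ih
  ... | true  | false | ih = trans (cong suc ih) (sym (+-suc _ _))

count-complement : (p : A → Bool) (xs : List A) → count p xs + count (not ∘ p) xs ≡ length xs
count-complement p []       = refl
count-complement p (x ∷ xs) with p x | count-complement p xs
... | true  | ih = cong suc ih
... | false | ih = trans (+-suc _ _) (cong suc ih)

length-≤-of-⊆ : (xs ys : List A) → Unique xs → (∀ {x} → x ∈ xs → x ∈ ys) → length xs ≤ length ys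
length-≤-of-⊆ []       ys _          _     = z≤n
length-≤-of-⊆ (x ∷ xs) ys (x∉xs ∷ u) xs⊆ys with ys₁ , ys₂ , refl ← ∈-∃++ (xs⊆ys (here refl)) =
  subst (suc (length xs) ≤_) (sym length-∷-middle)
    (s≤s (length-≤-of-⊆ xs (ys₁ ++ ys₂) u (λ y∈xs → ∈-delete ys₁ (xs⊆ys (there y∈xs)) (x≢y y∈xs))))
  where
  x≢y : ∀ {y} → y ∈ xs → y ≢ x
  x≢y y∈xs y≡x = All.lookup x∉xs y∈xs (sym y≡x)

  length-∷-middle : length (ys₁ ++ x ∷ ys₂) ≡ suc (length (ys₁ ++ ys₂))
  length-∷-middle = trans (List.length-++ ys₁) (trans (+-suc _ _) (cong suc (sym (List.length-++ ys₁))))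

  ∈-delete : ∀ {y z} (zs₁ : List A) {zs₂} → y ∈ zs₁ ++ z ∷ zs₂ → y ≢ z → y ∈ zs₁ ++ zs₂
  ∈-delete []        (here refl) y≢z = ⊥-elim (y≢z refl)
  ∈-delete []        (there y∈)  _   = y∈
  ∈-delete (_ ∷ zs₁) (here refl) _   = here refl
  ∈-delete (_ ∷ zs₁) (there y∈)  y≢z = there (∈-delete zs₁ y∈ y≢z)

Unique-map⁺ : (f : A → B) (xs : List A) → Unique xs
  → (∀ {x y} → x ∈ xs → y ∈ xs → f x ≡ f y → x ≡ y) → Unique (map f xs)
Unique-map⁺ f []       _          _   = []
Unique-map⁺ f (x ∷ xs) (x∉xs ∷ u) inj =
  All.tabulate fx∉ ∷ Unique-map⁺ f xs u (λ x∈ y∈ → inj (there x∈) (there y∈))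
  where
  fx∉ : ∀ {z} → z ∈ map f xs → f x ≢ z
  fx∉ z∈ fx≡z with y , y∈xs , refl ← ∈-map⁻ f z∈ = All.lookup x∉xs y∈xs (inj (here refl) (there y∈xs) fx≡z)

count-≤-by-injection : (p : A → Bool) (q : B → Bool) (f : A → B) (xs : List A) (ys : List B) → Unique xs
  → (∀ {x} → x ∈ xs → T (p x) → f x ∈ ys × T (q (f x)))
  → (∀ {x y} → x ∈ xs → y ∈ xs → T (p x) → T (p y) → f x ≡ f y → x ≡ y)
  → count p xs ≤ count q ys
count-≤-by-injection p q f xs ys u into inj =
  subst (_≤ count q ys) (List.length-map f (filterᵇ p xs))
    (length-≤-of-⊆ (map f (filterᵇ p xs)) (filterᵇ q ys)
      (Unique-map⁺ f _ (Unique.filter⁺ _ u) inj-filtered) image⊆)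
  where
  inj-filtered : ∀ {x y} → x ∈ filterᵇ p xs → y ∈ filterᵇ p xs → f x ≡ f y → x ≡ y
  inj-filtered x∈ y∈ =
    let x∈xs , px = ∈-filter⁻ _ x∈ ; y∈xs , py = ∈-filter⁻ _ y∈ in inj x∈xs y∈xs px py
  image⊆ : ∀ {z} → z ∈ map f (filterᵇ p xs) → z ∈ filterᵇ q ys
  image⊆ z∈ with x , x∈ , refl ← ∈-map⁻ f z∈ =
    let x∈xs , px = ∈-filter⁻ _ x∈ ; fx∈ys , qfx = into x∈xs px in ∈-filter⁺ _ fx∈ys qfx

∈[]⁻ : ∀ {n k} → k ∈ [ n ] → 1 ≤ k × k ≤ n
∈[]⁻ k∈ with j , j∈ , refl ← ∈-map⁻ suc k∈ = s≤s z≤n , ∈-upTo⁻ j∈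

∈[]⁺ : ∀ {n k} → 1 ≤ k → k ≤ n → k ∈ [ n ]
∈[]⁺ {k = suc k} _ k<n = ∈-map⁺ suc (∈-upTo⁺ k<n)

∈[]-suc : ∀ {n k} → k ∈ [ n ] → suc k ∈ [ suc n ]
∈[]-suc k∈ = let 1≤k , k≤n = ∈[]⁻ k∈ in ∈[]⁺ (s≤s z≤n) (s≤s k≤n)

1∈[suc] : ∀ {n} → 1 ∈ [ suc n ]
1∈[suc] = ∈[]⁺ (s≤s z≤n) (s≤s z≤n)

length-[] : ∀ n → length [ n ] ≡ n
length-[] n = trans (List.length-map suc (upTo n)) (List.length-upTo n)

Unique-[] : ∀ n → Unique [ n ]
Unique-[] n = Unique.map⁺ suc-injective (Unique.upTo⁺ n)

count-reindex : (n : ℕ) (p : ℕ → Bool) (h : ℕ → ℕ)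
  → (∀ {k} → k ∈ [ n ] → h k ∈ [ n ])
  → (∀ {k l} → k ∈ [ n ] → l ∈ [ n ] → h k ≡ h l → k ≡ l)
  → count (p ∘ h) [ n ] ≡ count p [ n ]
-- Injectivity bounds the count of both p and its complement, and the two counts sum to n.
count-reindex n p h into inj = ≤-antisym (≤-by-h p) (+-cancelʳ-≤ _ _ _ (begin
  count p [ n ] + count (not ∘ p ∘ h) [ n ] ≤⟨ +-monoʳ-≤ (count p [ n ]) (≤-by-h (not ∘ p)) ⟩
  count p [ n ] + count (not ∘ p) [ n ]     ≡⟨ count-complement p [ n ] ⟩
  length [ n ]                              ≡⟨ count-complement (p ∘ h) [ n ] ⟨
  count (p ∘ h) [ n ] + count (not ∘ p ∘ h) [ n ] ∎))
  where
  open ≤-Reasoning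
  ≤-by-h : (q : ℕ → Bool) → count (q ∘ h) [ n ] ≤ count q [ n ]
  ≤-by-h q = count-≤-by-injection (q ∘ h) q h [ n ] [ n ] (Unique-[] n)
    (λ k∈ qhk → into k∈ , qhk) (λ k∈ l∈ _ _ → inj k∈ l∈)

∈±[]⁺ : ∀ {n k} → k ∈ [ n ] → + k ∈ ±[ n ] × - (+ k) ∈ ±[ n ]
∈±[]⁺ {n} k∈ =
  ∈-++⁺ʳ (map (λ k → - (+ k)) [ n ]) (∈-map⁺ +_ k∈) , ∈-++⁺ˡ (∈-map⁺ (λ k → - (+ k)) k∈)

∈±[]⁻ : ∀ {n v} → v ∈ ±[ n ] → ∃ λ k → k ∈ [ n ] × (v ≡ + k ⊎ v ≡ - (+ k))
∈±[]⁻ {n} v∈ with ∈-++⁻ (map (λ k → - (+ k)) [ n ]) v∈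
... | inj₁ v∈⁻ = let k , k∈ , v≡ = ∈-map⁻ (λ k → - (+ k)) v∈⁻ in k , k∈ , inj₂ v≡
... | inj₂ v∈⁺ = let k , k∈ , v≡ = ∈-map⁻ +_ v∈⁺ in k , k∈ , inj₁ v≡

∣∣-∈±[] : ∀ {n v} → v ∈ ±[ n ] → ∣ v ∣ ∈ [ n ]
∣∣-∈±[] v∈ with ∈±[]⁻ v∈
... | k , k∈ , inj₁ refl = k∈
... | k , k∈ , inj₂ refl = subst (_∈ [ _ ]) (sym (ℤ.∣-i∣≡∣i∣ (+ k))) k∈

Unique-±[] : ∀ n → Unique ±[ n ]
Unique-±[] n = Unique.++⁺ (Unique.map⁺ (ℤ.+-injective ∘ ℤ.neg-injective) (Unique-[] n))
                          (Unique.map⁺ ℤ.+-injective (Unique-[] n)) disjoint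
  where
  disjoint : ∀ {v} → ¬ (v ∈ map (λ k → - (+ k)) [ n ] × v ∈ map +_ [ n ])
  disjoint (v∈⁻ , v∈⁺) with k , k∈ , refl ← ∈-map⁻ (λ k → - (+ k)) v∈⁻ | ∈[]⁻ k∈
  ... | s≤s z≤n , _ with _ , _ , () ← ∈-map⁻ +_ v∈⁺

_≗[_]_ : (ℕ → A) → ℕ → (ℕ → A) → Set
f ≗[ n ] g = ∀ {k} → k ∈ [ n ] → f k ≡ g k

build : (n : ℕ) → (ℕ → A) → Vec A n
build zero    f = []
build (suc n) f = f 1 ∷ build n (f ∘ suc)

at-build : (d : A) (n : ℕ) (f : ℕ → A) → at d (build n f) ≗[ n ] f
at-build d n f k∈ = go n f (∈[]⁻ k∈)
  where
  go : ∀ n (f : ℕ → _) {k} → 1 ≤ k × k ≤ n → at d (build n f) k ≡ f k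
  go (suc n) f {suc zero}    _              = refl
  go (suc n) f {suc (suc k)} (_ , s≤s k≤n) = go n (f ∘ suc) (s≤s z≤n , k≤n)

at-∷ : (d x : A) {n : ℕ} (v : Vec A n) {k : ℕ} → k ∈ [ n ] → at d (x ∷ v) (suc k) ≡ at d v k
at-∷ d x v {zero}  k∈ with () , _ ← ∈[]⁻ k∈
at-∷ d x v {suc k} _  = refl

at-ext : (d : A) {n : ℕ} (v w : Vec A n) → at d v ≗[ n ] at d w → v ≡ w
at-ext d []      []      _   = refl
at-ext d (x ∷ v) (y ∷ w) v≗w = cong₂ _∷_ (v≗w 1∈[suc]) (at-ext d v w tail≗)
  where
  tail≗ : at d v ≗[ _ ] at d w
  tail≗ k∈ = trans (sym (at-∷ d x v k∈)) (trans (v≗w (∈[]-suc k∈)) (at-∷ d y w k∈))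

∈-vecsOver⁺ : (d : A) (L : List A) {n : ℕ} (v : Vec A n)
  → (∀ {k} → k ∈ [ n ] → at d v k ∈ L) → v ∈ vecsOver L n
∈-vecsOver⁺ d L []      _    = here refl
∈-vecsOver⁺ d L (x ∷ v) v⊆L =
  ∈-concatMap⁺ _ (Any.map (λ { refl → ∈-map⁺ (x ∷_) (∈-vecsOver⁺ d L v tail⊆L) }) (v⊆L 1∈[suc]))
  where
  tail⊆L : ∀ {k} → k ∈ [ _ ] → at d v k ∈ L
  tail⊆L k∈ = subst (_∈ L) (at-∷ d x v k∈) (v⊆L (∈[]-suc k∈))

Unique-vecsOver : (L : List A) (n : ℕ) → Unique L → Unique (vecsOver L n)
Unique-vecsOver L zero    _  = All.[] ∷ []
Unique-vecsOver {A} L (suc n) uL = go L uL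
  where
  ∷-injectiveʳ : ∀ {a b : A} {v w : Vec A n} → _≡_ {A = Vec A (suc n)} (a ∷ v) (b ∷ w) → v ≡ w
  ∷-injectiveʳ refl = refl
  go : (M : List A) → Unique M → Unique (concatMap (λ a → map (a ∷_) (vecsOver L n)) M)
  go []      _           = []
  go (a ∷ M) (a∉M ∷ uM) =
    Unique.++⁺ (Unique.map⁺ ∷-injectiveʳ (Unique-vecsOver L n uL)) (go M uM) disjoint
    where
    disjoint : ∀ {z} → ¬ (z ∈ map (a ∷_) (vecsOver L n) × z ∈ concatMap (λ a → map (a ∷_) (vecsOver L n)) M)
    disjoint (z∈a , z∈M)
      with _ , _ , refl ← ∈-map⁻ (a ∷_) z∈a
      with b , b∈M , z∈b ← find (∈-concatMap⁻ _ {xs = M} z∈M)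
      with _ , _ , refl ← ∈-map⁻ (b ∷_) z∈b = All.lookup a∉M b∈M refl

T-all⁻ : (p : A → Bool) (xs : List A) → T (all p xs) → ∀ {x} → x ∈ xs → T (p x)
T-all⁻ p xs all-p = All.lookup (all⁺ p xs all-p)

T-all⁺ : (p : A → Bool) (xs : List A) → (∀ {x} → x ∈ xs → T (p x)) → T (all p xs)
T-all⁺ p xs p-all = all⁻ p (All.tabulate p-all)

T-any : (p : A → Bool) (xs : List A) → T (any p xs) ⇔ (∃ λ x → x ∈ xs × T (p x))
T-any p xs = mk⇔ (find ∘ any⁻ p xs) (λ (x , x∈ , px) → any⁺ p (lose x∈ px))

T-any-≟ : (_≟ᴬ_ : DecidableEquality A) (x : A) (ys : List A) → T (any (λ y → ⌊ x ≟ᴬ y ⌋) ys) ⇔ x ∈ ys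
T-any-≟ _≟ᴬ_ x ys = mk⇔
  (λ x∈ → let y , y∈ , x≡y = to (T-any _ ys) x∈ in subst (_∈ ys) (sym (toWitness x≡y)) y∈)
  (λ x∈ → from (T-any _ ys) (x , x∈ , fromWitness refl))

T-⇔⇒≡ : {a b : Bool} → T a ⇔ T b → a ≡ b
T-⇔⇒≡ {true}  {true}  _   = refl
T-⇔⇒≡ {false} {false} _   = refl
T-⇔⇒≡ {true}  {false} a⇔b = ⊥-elim (to a⇔b _)
T-⇔⇒≡ {false} {true}  a⇔b = ⊥-elim (from a⇔b _)

⌊⌋-cong-⇔ : {P Q : Set} (p? : Dec P) (q? : Dec Q) → P ⇔ Q → ⌊ p? ⌋ ≡ ⌊ q? ⌋
⌊⌋-cong-⇔ p? q? P⇔Q = T-⇔⇒≡ (mk⇔ (fromWitness ∘ to P⇔Q ∘ toWitness) (fromWitness ∘ from P⇔Q ∘ toWitness))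

T-not-∨ : {P : Set} (p? : Dec P) (b : Bool) → T (not ⌊ p? ⌋ ∨ b) ⇔ (P → T b)
T-not-∨ (yes p) b = mk⇔ (λ tb _ → tb) (λ p⇒b → p⇒b p)
T-not-∨ (no ¬p) b = mk⇔ (λ _ p → ⊥-elim (¬p p)) (λ _ → _)

T-∨-not : {P : Set} (p? : Dec P) (b : Bool) → T (b ∨ not ⌊ p? ⌋) ⇔ (P → T b)
T-∨-not p? b = subst (λ c → T c ⇔ _) (∨-comm (not ⌊ p? ⌋) b) (T-not-∨ p? b)

count-vecsOver-≤ : (d : A) (d′ : B) (L : List A) (L′ : List B) {n m : ℕ} → Unique L
  → (p : Vec A n → Bool) (q : Vec B m → Bool) (Φ : (ℕ → A) → (ℕ → B))
  → (∀ {v} → T (p v) → (∀ {k} → k ∈ [ m ] → Φ (at d v) k ∈ L′) × T (q (build m (Φ (at d v)))))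
  → (∀ {v w} → T (p v) → T (p w) → Φ (at d v) ≗[ m ] Φ (at d w) → at d v ≗[ n ] at d w)
  → count p (vecsOver L n) ≤ count q (vecsOver L′ m)
count-vecsOver-≤ d d′ L L′ {n} {m} uL p q Φ maps-to Φ-injective =
  count-≤-by-injection p q image (vecsOver L n) (vecsOver L′ m) (Unique-vecsOver L n uL) into injective
  where
  image : Vec _ n → Vec _ m
  image v = build m (Φ (at d v))
  into : ∀ {v} → v ∈ vecsOver L n → T (p v) → image v ∈ vecsOver L′ m × T (q (image v))
  into {v} _ pv = let Φv∈L′ , qΦv = maps-to pv in
    ∈-vecsOver⁺ d′ L′ (image v) (λ k∈ → subst (_∈ L′) (sym (at-build d′ m _ k∈)) (Φv∈L′ k∈)) , qΦv
  injective : ∀ {v w} → v ∈ vecsOver L n → w ∈ vecsOver L n → T (p v) → T (p w) → image v ≡ image w → v ≡ w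
  injective {v} {w} _ _ pv pw eq = at-ext d v w (Φ-injective pv pw λ k∈ →
    trans (sym (at-build d′ m _ k∈)) (trans (cong (λ u → at d′ u _) eq) (at-build d′ m _ k∈)))

count-vecsOver-≡ : (d : A) (d′ : B) (L : List A) (L′ : List B) {n m : ℕ} → Unique L → Unique L′
  → (p : Vec A n → Bool) (q : Vec B m → Bool) (Φ : (ℕ → A) → (ℕ → B)) (Ψ : (ℕ → B) → (ℕ → A))
  → (∀ {v} → T (p v) → (∀ {k} → k ∈ [ m ] → Φ (at d v) k ∈ L′) × T (q (build m (Φ (at d v)))))
  → (∀ {w} → T (q w) → (∀ {k} → k ∈ [ n ] → Ψ (at d′ w) k ∈ L) × T (p (build n (Ψ (at d′ w)))))
  → (∀ {v} → T (p v) → Ψ (Φ (at d v)) ≗[ n ] at d v)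
  → (∀ {w} → T (q w) → Φ (Ψ (at d′ w)) ≗[ m ] at d′ w)
  → (∀ {f g} → f ≗[ n ] g → Φ f ≗[ m ] Φ g)
  → (∀ {f g} → f ≗[ m ] g → Ψ f ≗[ n ] Ψ g)
  → count p (vecsOver L n) ≡ count q (vecsOver L′ m)
count-vecsOver-≡ d d′ L L′ uL uL′ p q Φ Ψ Φ-into Ψ-into Ψ∘Φ Φ∘Ψ Φ-≗ Ψ-≗ = ≤-antisym
  (count-vecsOver-≤ d d′ L L′ uL p q Φ Φ-into (λ pv pw Φv≗Φw k∈ →
    trans (sym (Ψ∘Φ pv k∈)) (trans (Ψ-≗ Φv≗Φw k∈) (Ψ∘Φ pw k∈))))
  (count-vecsOver-≤ d′ d L′ L uL′ q p Ψ Ψ-into (λ qv qw Ψv≗Ψw k∈ →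
    trans (sym (Φ∘Ψ qv k∈)) (trans (Φ-≗ Ψv≗Ψw k∈) (Φ∘Ψ qw k∈))))

-- Permutations of [n] with no fixed point above a

record IsPermutation (n : ℕ) (f : ℕ → ℕ) : Set where
  field
    into      : ∀ {k} → k ∈ [ n ] → f k ∈ [ n ]
    injective : ∀ {k l} → k ∈ [ n ] → l ∈ [ n ] → f k ≡ f l → k ≡ l

  surjective : ∀ {l} → l ∈ [ n ] → ∃ λ k → k ∈ [ n ] × f k ≡ l
  surjective {l} l∈ with l ∈? map f [ n ]
  ... | yes l∈image = let k , k∈ , l≡fk = ∈-map⁻ f l∈image in k , k∈ , sym l≡fk
  ... | no  l∉image = ⊥-elim (<-irrefl refl (begin-strict
    n                       ≡⟨ length-image ⟨
    length (map f [ n ])    <⟨ ≤-refl ⟩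
    length (l ∷ map f [ n ]) ≤⟨ length-≤-of-⊆ (l ∷ map f [ n ]) [ n ] unique image⊆ ⟩
    length [ n ]            ≡⟨ length-[] n ⟩
    n                       ∎))
    where
    open ≤-Reasoning
    length-image : length (map f [ n ]) ≡ n
    length-image = trans (List.length-map f [ n ]) (length-[] n)
    unique : Unique (l ∷ map f [ n ])
    unique = All.tabulate (λ l′∈ l≡l′ → l∉image (subst (_∈ _) (sym l≡l′) l′∈))
           ∷ Unique-map⁺ f [ n ] (Unique-[] n) injective
    image⊆ : ∀ {x} → x ∈ l ∷ map f [ n ] → x ∈ [ n ]
    image⊆ (here refl) = l∈
    image⊆ (there x∈) with k , k∈ , refl ← ∈-map⁻ f x∈ = into k∈

NoFixedPointAbove : ℕ → ℕ → (ℕ → ℕ) → Set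
NoFixedPointAbove n a f = ∀ {k} → k ∈ [ n ] → f k ≡ k → k ≤ a

record IsDerangementAbove (n a : ℕ) (f : ℕ → ℕ) : Set where
  field
    isPermutation : IsPermutation n f
    fixed≤        : NoFixedPointAbove n a f

  open IsPermutation isPermutation public

excᶠ : ℕ → (ℕ → ℕ) → ℕ
excᶠ n f = count (λ k → ⌊ k <? f k ⌋) [ n ]

noFixedPointAbove : {n : ℕ} → ℕ → Vec ℕ n → Bool
noFixedPointAbove {n} a π = all (λ k → ⌊ k ≤? a ⌋ ∨ not ⌊ π⟨ π ⟩ k ≟ k ⌋) [ n ]

isDerangementAbove : {n : ℕ} → ℕ → Vec ℕ n → Bool
isDerangementAbove a π = isPerm π ∧ noFixedPointAbove a π

T-isPerm : {n : ℕ} (π : Vec ℕ n) {f : ℕ → ℕ} → π⟨ π ⟩ ≗[ n ] f → T (isPerm π) ⇔ IsPermutation n f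
T-isPerm {n} π {f} π≗f = mk⇔ to-perm from-perm
  where
  into? = λ k → any (λ j → ⌊ π⟨ π ⟩ k ≟ j ⌋) [ n ]
  injective? = λ k l → ⌊ k ≟ l ⌋ ∨ not ⌊ π⟨ π ⟩ k ≟ π⟨ π ⟩ l ⌋
  into⇔ : ∀ {k} → k ∈ [ n ] → T (into? k) ⇔ f k ∈ [ n ]
  into⇔ k∈ rewrite π≗f k∈ = T-any-≟ _≟_ _ [ n ]
  injective⇔ : ∀ {k l} → k ∈ [ n ] → l ∈ [ n ] → T (injective? k l) ⇔ (f k ≡ f l → k ≡ l)
  injective⇔ {k} {l} k∈ l∈ rewrite sym (π≗f k∈) | sym (π≗f l∈) = mk⇔
    (λ h eq → toWitness (to (T-∨-not (_ ≟ _) _) h eq))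
    (λ h → from (T-∨-not (_ ≟ _) _) (fromWitness ∘ h))
  to-perm : T (isPerm π) → IsPermutation n f
  to-perm h = let into-b , inj-b = to T-∧ h in record
    { into      = λ k∈ → to (into⇔ k∈) (T-all⁻ into? [ n ] into-b k∈)
    ; injective = λ k∈ l∈ → to (injective⇔ k∈ l∈) (T-all⁻ _ [ n ] (T-all⁻ _ [ n ] inj-b k∈) l∈)
    }
  from-perm : IsPermutation n f → T (isPerm π)
  from-perm p = from T-∧
    ( T-all⁺ into? [ n ] (λ k∈ → from (into⇔ k∈) (IsPermutation.into p k∈))
    , T-all⁺ _ [ n ] (λ k∈ → T-all⁺ _ [ n ] (λ l∈ →
        from (injective⇔ k∈ l∈) (IsPermutation.injective p k∈ l∈))) )

T-isDerangementAbove : {n : ℕ} (a : ℕ) (π : Vec ℕ n) {f : ℕ → ℕ} → π⟨ π ⟩ ≗[ n ] f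
  → T (isDerangementAbove a π) ⇔ IsDerangementAbove n a f
T-isDerangementAbove {n} a π {f} π≗f = mk⇔ to-der from-der
  where
  fixed? = λ k → ⌊ k ≤? a ⌋ ∨ not ⌊ π⟨ π ⟩ k ≟ k ⌋
  fixed⇔ : ∀ {k} → k ∈ [ n ] → T (fixed? k) ⇔ (f k ≡ k → k ≤ a)
  fixed⇔ k∈ rewrite sym (π≗f k∈) = mk⇔
    (λ h eq → toWitness (to (T-∨-not (_ ≟ _) _) h eq))
    (λ h → from (T-∨-not (_ ≟ _) _) (fromWitness ∘ h))
  to-der : T (isDerangementAbove a π) → IsDerangementAbove n a f
  to-der h = let perm , fixed = to T-∧ h in record
    { isPermutation = to (T-isPerm π π≗f) perm
    ; fixed≤        = λ k∈ → to (fixed⇔ k∈) (T-all⁻ fixed? [ n ] fixed k∈)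
    }
  from-der : IsDerangementAbove n a f → T (isDerangementAbove a π)
  from-der d = from T-∧
    ( from (T-isPerm π π≗f) (IsDerangementAbove.isPermutation d)
    , T-all⁺ fixed? [ n ] (λ k∈ → from (fixed⇔ k∈) (IsDerangementAbove.fixed≤ d k∈)) )

excᶠ-≗ : ∀ {n f g} → f ≗[ n ] g → excᶠ n f ≡ excᶠ n g
excᶠ-≗ f≗g = count-cong _ (λ {k} k∈ → cong (λ v → ⌊ k <? v ⌋) (f≗g k∈))

-- Opaque, so that this predicate is only used through its reflection lemma: letting the
-- conversion checker unfold it makes type checking very slow.
opaque
  isDerangementAboveWithExc : {n : ℕ} → ℕ → ℕ → Vec ℕ n → Bool
  isDerangementAboveWithExc a e π = isDerangementAbove a π ∧ ⌊ exc π ≟ e ⌋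

  isDerangementAboveWithExc-zero : {n : ℕ} (e : ℕ) (π : Vec ℕ n)
    → isDerangementAboveWithExc 0 e π ≡ (isDerangement π ∧ ⌊ exc π ≟ e ⌋)
  isDerangementAboveWithExc-zero {n} e π = cong (λ b → (isPerm π ∧ b) ∧ ⌊ exc π ≟ e ⌋) (all-cong [ n ] false∨)
    where
    false∨ : ∀ {k} → k ∈ [ n ] → (⌊ k ≤? 0 ⌋ ∨ not ⌊ π⟨ π ⟩ k ≟ k ⌋) ≡ not ⌊ π⟨ π ⟩ k ≟ k ⌋
    false∨ {suc k} _  = refl
    false∨ {zero}  k∈ with () , _ ← ∈[]⁻ k∈

  T-isDerangementAboveWithExc : {n : ℕ} (a e : ℕ) (π : Vec ℕ n) {f : ℕ → ℕ} → π⟨ π ⟩ ≗[ n ] f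
    → T (isDerangementAboveWithExc a e π) ⇔ (IsDerangementAbove n a f × excᶠ n f ≡ e)
  T-isDerangementAboveWithExc a e π π≗f = mk⇔
    (λ h → let d , ex = to T-∧ h in to (T-isDerangementAbove a π π≗f) d , trans (sym (excᶠ-≗ π≗f)) (toWitness ex))
    (λ (d , ex) → from T-∧ (from (T-isDerangementAbove a π π≗f) d , fromWitness (trans (excᶠ-≗ π≗f) ex)))

dCoeffAbove : ℕ → ℕ → ℕ → ℕ
dCoeffAbove n a e = count (isDerangementAboveWithExc a e) (vecsOver [ n ] n)

-- Deleting and inserting a fixed point

-- As Data.Fin.punchIn/punchOut, on ℕ and around the point suc a.
punchIn : ℕ → ℕ → ℕ
punchIn a j with j ≤? a
... | yes _ = j
... | no  _ = suc j

punchOut : ℕ → ℕ → ℕ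
punchOut a v with v ≤? a
... | yes _ = v
... | no  _ = pred v

module _ (a : ℕ) where

  punchOut-punchIn : ∀ j → punchOut a (punchIn a j) ≡ j
  punchOut-punchIn j with j ≤? a
  ... | yes j≤a with j ≤? a
  ...   | yes _   = refl
  ...   | no  j≰a = ⊥-elim (j≰a j≤a)
  punchOut-punchIn j | no j≰a with suc j ≤? a
  ...   | yes 1+j≤a = ⊥-elim (j≰a (≤-trans (n≤1+n j) 1+j≤a))
  ...   | no  _     = refl

  punchIn-punchOut : ∀ {v} → v ≢ suc a → punchIn a (punchOut a v) ≡ v
  punchIn-punchOut {v} v≢1+a with v ≤? a
  ... | yes v≤a with v ≤? a
  ...   | yes _   = refl
  ...   | no  v≰a = ⊥-elim (v≰a v≤a)
  punchIn-punchOut {zero}  v≢1+a | no v≰a = ⊥-elim (v≰a z≤n)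
  punchIn-punchOut {suc v} v≢1+a | no v≰a with v ≤? a
  ...   | yes v≤a = ⊥-elim (v≢1+a (cong suc (≤-antisym v≤a (≤-pred (≰⇒> v≰a)))))
  ...   | no  _   = refl

  punchIn≢ : ∀ j → punchIn a j ≢ suc a
  punchIn≢ j with j ≤? a
  ... | yes j≤a = λ j≡1+a → <-irrefl refl (subst (_≤ a) j≡1+a j≤a)
  ... | no  j≰a = λ 1+j≡1+a → j≰a (≤-reflexive (suc-injective 1+j≡1+a))

  punchIn-injective : ∀ {j k} → punchIn a j ≡ punchIn a k → j ≡ k
  punchIn-injective {j} {k} eq =
    trans (sym (punchOut-punchIn j)) (trans (cong (punchOut a) eq) (punchOut-punchIn k))

  punchIn-mono-< : ∀ {j k} → j < k → punchIn a j < punchIn a k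
  punchIn-mono-< {j} {k} j<k with j ≤? a | k ≤? a
  ... | yes _   | yes _   = j<k
  ... | yes _   | no  _   = m≤n⇒m≤1+n j<k
  ... | no  j≰a | yes k≤a = ⊥-elim (j≰a (≤-trans (<⇒≤ j<k) k≤a))
  ... | no  _   | no  _   = s≤s j<k

  punchIn-<? : ∀ j k → ⌊ punchIn a j <? punchIn a k ⌋ ≡ ⌊ j <? k ⌋
  punchIn-<? j k = ⌊⌋-cong-⇔ (_ <? _) (j <? k) (mk⇔ cancel punchIn-mono-<)
    where
    cancel : punchIn a j < punchIn a k → j < k
    cancel pj<pk with <-cmp j k
    ... | tri< j<k _    _   = j<k
    ... | tri≈ _   refl _   = ⊥-elim (<-irrefl refl pj<pk)
    ... | tri> _   _    k<j = ⊥-elim (<-asym pj<pk (punchIn-mono-< k<j))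

  punchIn-> : ∀ {j} → a < j → punchIn a j ≡ suc j
  punchIn-> {j} a<j with j ≤? a
  ... | yes j≤a = ⊥-elim (<⇒≱ a<j j≤a)
  ... | no  _   = refl

  punchOut-> : ∀ {v} → suc a < v → a < punchOut a v
  punchOut-> {v} 1+a<v with v ≤? a
  ... | yes v≤a = ⊥-elim (<⇒≱ (<-trans (n<1+n a) 1+a<v) v≤a)
  punchOut-> {suc v} (s≤s 1+a≤v) | no _ = 1+a≤v

  module _ {n : ℕ} (a<1+n : a < suc n) where

    punchIn-∈ : ∀ {j} → j ∈ [ n ] → punchIn a j ∈ [ suc n ]
    punchIn-∈ {j} j∈ with ∈[]⁻ j∈ | j ≤? a
    ... | 1≤j , j≤n | yes _ = ∈[]⁺ 1≤j (m≤n⇒m≤1+n j≤n)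
    ... | 1≤j , j≤n | no  _ = ∈[]⁺ (s≤s z≤n) (s≤s j≤n)

    punchOut-∈ : ∀ {v} → v ∈ [ suc n ] → v ≢ suc a → punchOut a v ∈ [ n ]
    punchOut-∈ {v} v∈ v≢1+a with ∈[]⁻ v∈ | v ≤? a
    ... | 1≤v , _ | yes v≤a = ∈[]⁺ 1≤v (≤-trans v≤a (≤-pred a<1+n))
    punchOut-∈ {suc v} v∈ v≢1+a | _ , s≤s v≤n | no v≰a =
      ∈[]⁺ (≤-trans (s≤s z≤n) a<v) v≤n
      where
      a<v : a < v
      a<v = ≤∧≢⇒< (≤-pred (≰⇒> v≰a)) (λ a≡v → v≢1+a (cong suc (sym a≡v)))

    count-punchIn : (q : ℕ → Bool) → q (suc a) ≡ false → count q [ suc n ] ≡ count (q ∘ punchIn a) [ n ]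
    count-punchIn q q[1+a]≡false = ≤-antisym
      (count-≤-by-injection q (q ∘ punchIn a) (punchOut a) [ suc n ] [ n ] (Unique-[] (suc n))
        (λ v∈ qv → punchOut-∈ v∈ (≢1+a qv) , subst (T ∘ q) (sym (punchIn-punchOut (≢1+a qv))) qv)
        (λ _ _ qv qw eq → trans (sym (punchIn-punchOut (≢1+a qv)))
                                (trans (cong (punchIn a) eq) (punchIn-punchOut (≢1+a qw)))))
      (count-≤-by-injection (q ∘ punchIn a) q (punchIn a) [ n ] [ suc n ] (Unique-[] n)
        (λ j∈ qj → punchIn-∈ j∈ , qj) (λ _ _ _ _ → punchIn-injective))
      where
      ≢1+a : ∀ {v} → T (q v) → v ≢ suc a
      ≢1+a qv refl = subst T q[1+a]≡false qv

removePoint : ℕ → (ℕ → ℕ) → ℕ → ℕ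
removePoint a f j = punchOut a (f (punchIn a j))

insertFixedPoint : ℕ → (ℕ → ℕ) → ℕ → ℕ
insertFixedPoint a f k with k ≟ suc a
... | yes _ = suc a
... | no  _ = punchIn a (f (punchOut a k))

module FixedPointInsertion (a n : ℕ) (a<1+n : a < suc n) where

  1+a∈ : suc a ∈ [ suc n ]
  1+a∈ = ∈[]⁺ (s≤s z≤n) a<1+n

  insertFixedPoint-fixed : ∀ f → insertFixedPoint a f (suc a) ≡ suc a
  insertFixedPoint-fixed f with suc a ≟ suc a
  ... | yes _       = refl
  ... | no  1+a≢1+a = ⊥-elim (1+a≢1+a refl)

  insertFixedPoint-≢ : ∀ f {k} → k ≢ suc a → insertFixedPoint a f k ≡ punchIn a (f (punchOut a k))
  insertFixedPoint-≢ f {k} k≢1+a with k ≟ suc a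
  ... | yes k≡1+a = ⊥-elim (k≢1+a k≡1+a)
  ... | no  _     = refl

  insertFixedPoint-punchIn : ∀ f j → insertFixedPoint a f (punchIn a j) ≡ punchIn a (f j)
  insertFixedPoint-punchIn f j =
    trans (insertFixedPoint-≢ f (punchIn≢ a j)) (cong (punchIn a ∘ f) (punchOut-punchIn a j))

  removePoint-insertFixedPoint : ∀ f j → removePoint a (insertFixedPoint a f) j ≡ f j
  removePoint-insertFixedPoint f j =
    trans (cong (punchOut a) (insertFixedPoint-punchIn f j)) (punchOut-punchIn a (f j))

  removePoint-≗ : ∀ {f g} → f ≗[ suc n ] g → removePoint a f ≗[ n ] removePoint a g
  removePoint-≗ f≗g j∈ = cong (punchOut a) (f≗g (punchIn-∈ a a<1+n j∈))

  insertFixedPoint-≗ : ∀ {f g} → f ≗[ n ] g → insertFixedPoint a f ≗[ suc n ] insertFixedPoint a g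
  insertFixedPoint-≗ {f} {g} f≗g {k} k∈ with k ≟ suc a
  ... | yes _     = refl
  ... | no  k≢1+a = cong (punchIn a) (f≗g (punchOut-∈ a a<1+n k∈ k≢1+a))

  excᶠ-punchIn : ∀ f g → f (suc a) ≡ suc a → (∀ {j} → j ∈ [ n ] → f (punchIn a j) ≡ punchIn a (g j))
    → excᶠ (suc n) f ≡ excᶠ n g
  excᶠ-punchIn f g fixed f∘punchIn≗ = begin
    count (λ k → ⌊ k <? f k ⌋) [ suc n ]
      ≡⟨ count-punchIn a a<1+n (λ k → ⌊ k <? f k ⌋) 1+a-not-excedance ⟩
    count (λ j → ⌊ punchIn a j <? f (punchIn a j) ⌋) [ n ]
      ≡⟨ count-cong [ n ] (λ {j} j∈ →
           trans (cong (λ v → ⌊ punchIn a j <? v ⌋) (f∘punchIn≗ j∈)) (punchIn-<? a j (g j))) ⟩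
    count (λ j → ⌊ j <? g j ⌋) [ n ] ∎
    where
    open ≡-Reasoning
    1+a-not-excedance : ⌊ suc a <? f (suc a) ⌋ ≡ false
    1+a-not-excedance = trans (isYes≗does (suc a <? f (suc a))) (dec-false (suc a <? f (suc a)) (<-irrefl (sym fixed)))

  module Removal {f : ℕ → ℕ} (d : IsDerangementAbove (suc n) (suc a) f) (fixed : f (suc a) ≡ suc a) where
    open IsDerangementAbove d

    f≢1+a : ∀ {k} → k ∈ [ suc n ] → k ≢ suc a → f k ≢ suc a
    f≢1+a k∈ k≢1+a fk≡1+a = k≢1+a (injective k∈ 1+a∈ (trans fk≡1+a (sym fixed)))

    f∘punchIn≢ : ∀ {j} → j ∈ [ n ] → f (punchIn a j) ≢ suc a
    f∘punchIn≢ {j} j∈ = f≢1+a (punchIn-∈ a a<1+n j∈) (punchIn≢ a j)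

    f∘punchIn≗ : ∀ {j} → j ∈ [ n ] → f (punchIn a j) ≡ punchIn a (removePoint a f j)
    f∘punchIn≗ j∈ = sym (punchIn-punchOut a (f∘punchIn≢ j∈))

    removePoint-isDerangementAbove : IsDerangementAbove n a (removePoint a f)
    removePoint-isDerangementAbove = record
      { isPermutation = record
        { into      = λ j∈ → punchOut-∈ a a<1+n (into (punchIn-∈ a a<1+n j∈)) (f∘punchIn≢ j∈)
        ; injective = λ j∈ k∈ eq → punchIn-injective a (injective (punchIn-∈ a a<1+n j∈) (punchIn-∈ a a<1+n k∈)
                        (trans (f∘punchIn≗ j∈) (trans (cong (punchIn a) eq) (sym (f∘punchIn≗ k∈)))))
        }
      ; fixed≤ = fixed≤-removePoint
      }
      where
      fixed≤-removePoint : NoFixedPointAbove n a (removePoint a f)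
      fixed≤-removePoint {j} j∈ fixes-j = ≮⇒≥ λ a<j →
        <⇒≱ (s≤s a<j) (subst (_≤ suc a) (punchIn-> a a<j)
          (fixed≤ (punchIn-∈ a a<1+n j∈) (trans (f∘punchIn≗ j∈) (cong (punchIn a) fixes-j))))

    excᶠ-removePoint : excᶠ (suc n) f ≡ excᶠ n (removePoint a f)
    excᶠ-removePoint = excᶠ-punchIn f (removePoint a f) fixed f∘punchIn≗

    insertFixedPoint-removePoint : insertFixedPoint a (removePoint a f) ≗[ suc n ] f
    insertFixedPoint-removePoint {k} k∈ with k ≟ suc a
    ... | yes refl    = sym fixed
    ... | no  k≢1+a = trans (cong (punchIn a ∘ punchOut a ∘ f) (punchIn-punchOut a k≢1+a))
                            (punchIn-punchOut a (f≢1+a k∈ k≢1+a))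

  module Insertion {f : ℕ → ℕ} (d : IsDerangementAbove n a f) where
    open IsDerangementAbove d

    insertFixedPoint-isDerangementAbove : IsDerangementAbove (suc n) (suc a) (insertFixedPoint a f)
    insertFixedPoint-isDerangementAbove = record
      { isPermutation = record { into = into′ ; injective = injective′ }
      ; fixed≤        = fixed≤′
      }
      where
      into′ : ∀ {k} → k ∈ [ suc n ] → insertFixedPoint a f k ∈ [ suc n ]
      into′ {k} k∈ with k ≟ suc a
      ... | yes _     = 1+a∈
      ... | no  k≢1+a = punchIn-∈ a a<1+n (into (punchOut-∈ a a<1+n k∈ k≢1+a))
      injective′ : ∀ {k l} → k ∈ [ suc n ] → l ∈ [ suc n ]
        → insertFixedPoint a f k ≡ insertFixedPoint a f l → k ≡ l
      injective′ {k} {l} k∈ l∈ eq with k ≟ suc a | l ≟ suc a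
      ... | yes refl  | yes refl  = refl
      ... | yes _     | no  _     = ⊥-elim (punchIn≢ a (f (punchOut a l)) (sym eq))
      ... | no  _     | yes _     = ⊥-elim (punchIn≢ a (f (punchOut a k)) eq)
      ... | no  k≢1+a | no  l≢1+a =
        trans (sym (punchIn-punchOut a k≢1+a))
          (trans (cong (punchIn a) (injective (punchOut-∈ a a<1+n k∈ k≢1+a) (punchOut-∈ a a<1+n l∈ l≢1+a)
                                              (punchIn-injective a eq)))
                 (punchIn-punchOut a l≢1+a))
      fixed≤′ : NoFixedPointAbove (suc n) (suc a) (insertFixedPoint a f)
      fixed≤′ {k} k∈ fixes-k with k ≟ suc a
      ... | yes refl  = ≤-refl
      ... | no  k≢1+a = ≮⇒≥ λ 1+a<k → <⇒≱ (punchOut-> a 1+a<k) (fixed≤ (punchOut-∈ a a<1+n k∈ k≢1+a)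
          (trans (sym (punchOut-punchIn a _)) (cong (punchOut a) fixes-k)))

    excᶠ-insertFixedPoint : excᶠ (suc n) (insertFixedPoint a f) ≡ excᶠ n f
    excᶠ-insertFixedPoint =
      excᶠ-punchIn (insertFixedPoint a f) f (insertFixedPoint-fixed f) (λ {j} _ → insertFixedPoint-punchIn f j)

  fixes : Vec ℕ (suc n) → Bool
  fixes π = ⌊ π⟨ π ⟩ (suc a) ≟ suc a ⌋

  fixing unfixing : ℕ → Vec ℕ (suc n) → Bool
  fixing   e π = isDerangementAboveWithExc (suc a) e π ∧ fixes π
  unfixing e π = isDerangementAboveWithExc (suc a) e π ∧ not (fixes π)

  count-fixing≡dCoeffAbove : ∀ e → count (fixing e) (vecsOver [ suc n ] (suc n)) ≡ dCoeffAbove n a e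
  count-fixing≡dCoeffAbove e = count-vecsOver-≡ 0 0 [ suc n ] [ n ] (Unique-[] (suc n)) (Unique-[] n)
    (fixing e) (isDerangementAboveWithExc a e) (removePoint a) (insertFixedPoint a)
    removal-into insertion-into
    (λ {π} h → let (d , _) , fixed = unpack {π} h in Removal.insertFixedPoint-removePoint d fixed)
    (λ {π} _ {j} _ → removePoint-insertFixedPoint π⟨ π ⟩ j)
    removePoint-≗ insertFixedPoint-≗
    where
    unpack : ∀ {π} → T (fixing e π)
      → (IsDerangementAbove (suc n) (suc a) π⟨ π ⟩ × excᶠ (suc n) π⟨ π ⟩ ≡ e) × π⟨ π ⟩ (suc a) ≡ suc a
    unpack {π} h = let counted , fixed = to T-∧ h in
      to (T-isDerangementAboveWithExc (suc a) e π (λ _ → refl)) counted , toWitness fixed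
    removal-into : ∀ {π} → T (fixing e π)
      → (∀ {j} → j ∈ [ n ] → removePoint a π⟨ π ⟩ j ∈ [ n ])
      × T (isDerangementAboveWithExc a e (build n (removePoint a π⟨ π ⟩)))
    removal-into {π} h =
      let (d , ex) , fixed = unpack {π} h
          removed = Removal.removePoint-isDerangementAbove d fixed
      in IsDerangementAbove.into removed ,
         from (T-isDerangementAboveWithExc a e _ (at-build 0 n (removePoint a π⟨ π ⟩)))
              (removed , trans (sym (Removal.excᶠ-removePoint d fixed)) ex)
    insertion-into : ∀ {π} → T (isDerangementAboveWithExc a e π)
      → (∀ {k} → k ∈ [ suc n ] → insertFixedPoint a π⟨ π ⟩ k ∈ [ suc n ])
      × T (fixing e (build (suc n) (insertFixedPoint a π⟨ π ⟩)))
    insertion-into {π} h =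
      let d , ex = to (T-isDerangementAboveWithExc a e π (λ _ → refl)) h
          inserted = Insertion.insertFixedPoint-isDerangementAbove d
      in IsDerangementAbove.into inserted ,
         from T-∧ ( from (T-isDerangementAboveWithExc (suc a) e _ (at-build 0 (suc n) (insertFixedPoint a π⟨ π ⟩)))
                         (inserted , trans (Insertion.excᶠ-insertFixedPoint d) ex)
                  , fromWitness (trans (at-build 0 (suc n) (insertFixedPoint a π⟨ π ⟩) 1+a∈)
                                       (insertFixedPoint-fixed π⟨ π ⟩)) )

  isDerangementAbove-unfixed : ∀ {f}
    → (IsDerangementAbove (suc n) (suc a) f × f (suc a) ≢ suc a) ⇔ IsDerangementAbove (suc n) a f
  isDerangementAbove-unfixed = mk⇔
    (λ (d , unfixed) → record
      { isPermutation = IsDerangementAbove.isPermutation d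
      ; fixed≤        = λ {k} k∈ fixes-k → ≤-pred (≤∧≢⇒< (IsDerangementAbove.fixed≤ d k∈ fixes-k)
                                                          (λ { refl → unfixed fixes-k }))
      })
    (λ d → record
      { isPermutation = IsDerangementAbove.isPermutation d
      ; fixed≤        = λ k∈ fixes-k → m≤n⇒m≤1+n (IsDerangementAbove.fixed≤ d k∈ fixes-k)
      } , λ fixes-1+a → <-irrefl refl (IsDerangementAbove.fixed≤ d 1+a∈ fixes-1+a))

  count-unfixing≡dCoeffAbove : ∀ e → count (unfixing e) (vecsOver [ suc n ] (suc n)) ≡ dCoeffAbove (suc n) a e
  count-unfixing≡dCoeffAbove e = count-cong (vecsOver [ suc n ] (suc n)) λ {π} _ → T-⇔⇒≡ (mk⇔
    (λ h → let counted , unfixed = to (T-∧ {isDerangementAboveWithExc (suc a) e π}) h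
               d , ex = to (T-counted (suc a) π) counted in
       from (T-counted a π) (to isDerangementAbove-unfixed (d , toWitnessFalse unfixed) , ex))
    (λ h → let d , ex = to (T-counted a π) h ; d′ , unfixed = from isDerangementAbove-unfixed d in
       from T-∧ (from (T-counted (suc a) π) (d′ , ex) , fromWitnessFalse {a? = π⟨ π ⟩ (suc a) ≟ suc a} unfixed)))
    where
    T-counted : ∀ b (π : Vec ℕ (suc n))
      → T (isDerangementAboveWithExc b e π) ⇔ (IsDerangementAbove (suc n) b π⟨ π ⟩ × excᶠ (suc n) π⟨ π ⟩ ≡ e)
    T-counted b π = T-isDerangementAboveWithExc b e π (λ _ → refl)

  dCoeffAbove-suc : ∀ e → dCoeffAbove (suc n) (suc a) e ≡ dCoeffAbove (suc n) a e + dCoeffAbove n a e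
  dCoeffAbove-suc e = begin
    dCoeffAbove (suc n) (suc a) e                      ≡⟨ count-split perms ⟩
    count (fixing e) perms + count (unfixing e) perms  ≡⟨ +-comm (count (fixing e) perms) _ ⟩
    count (unfixing e) perms + count (fixing e) perms  ≡⟨ cong₂ _+_ (count-unfixing≡dCoeffAbove e)
                                                                     (count-fixing≡dCoeffAbove e) ⟩
    dCoeffAbove (suc n) a e + dCoeffAbove n a e        ∎
    where
    open ≡-Reasoning
    perms = vecsOver [ suc n ] (suc n)

dCoeffAbove-zero : ∀ n e → dCoeffAbove n 0 e ≡ dCoeff n e
dCoeffAbove-zero n e = count-cong (vecsOver [ n ] n) λ {π} _ → isDerangementAboveWithExc-zero e π

-- Signed derangements with prescribed negative entries

record IsSignedDerangement (n i : ℕ) (s : ℕ → ℤ) : Set where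
  field
    into             : ∀ {k} → k ∈ [ n ] → s k ∈ ±[ n ]
    ∣∣-injective     : ∀ {k l} → k ∈ [ n ] → l ∈ [ n ] → ∣ s k ∣ ≡ ∣ s l ∣ → k ≡ l
    no-fixed-point   : ∀ {k} → k ∈ [ n ] → s k ≢ + k
    negative⇒target : ∀ {k} → k ∈ [ n ] → s k ℤ.< + 0 → s k ∈ negTarget n i
    target⇒negative : ∀ {v} → v ∈ negTarget n i → ∃ λ k → k ∈ [ n ] × s k ≡ v × s k ℤ.< + 0

  ∣∣-into : ∀ {k} → k ∈ [ n ] → ∣ s k ∣ ∈ [ n ]
  ∣∣-into = ∣∣-∈±[] ∘ into

excBᶠ : ℕ → (ℕ → ℤ) → ℕ
excBᶠ n s = count (λ k → ⌊ s k ℤ.<? s ∣ s k ∣ ⌋) [ n ]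

IsSignedDerangement-≗ : ∀ {n i s t} → s ≗[ n ] t → IsSignedDerangement n i s → IsSignedDerangement n i t
IsSignedDerangement-≗ {n} {i} {s} {t} s≗t d = record
  { into             = λ k∈ → subst (_∈ ±[ n ]) (s≗t k∈) (into k∈)
  ; ∣∣-injective     = λ k∈ l∈ eq →
      ∣∣-injective k∈ l∈ (trans (cong ∣_∣ (s≗t k∈)) (trans eq (cong ∣_∣ (sym (s≗t l∈)))))
  ; no-fixed-point   = λ k∈ eq → no-fixed-point k∈ (trans (s≗t k∈) eq)
  ; negative⇒target = λ k∈ neg →
      subst (_∈ negTarget n i) (s≗t k∈) (negative⇒target k∈ (subst (ℤ._< + 0) (sym (s≗t k∈)) neg))
  ; target⇒negative = λ v∈ → let k , k∈ , eq , neg = target⇒negative v∈ in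
                        k , k∈ , trans (sym (s≗t k∈)) eq , subst (ℤ._< + 0) (s≗t k∈) neg
  }
  where open IsSignedDerangement d

excBᶠ-≗ : ∀ {n i s t} → IsSignedDerangement n i s → s ≗[ n ] t → excBᶠ n s ≡ excBᶠ n t
excBᶠ-≗ {n} {s = s} {t} d s≗t = count-cong [ n ] λ k∈ →
  cong₂ (λ x y → ⌊ x ℤ.<? y ⌋) (s≗t k∈)
        (trans (s≗t (IsSignedDerangement.∣∣-into d k∈)) (cong (t ∘ ∣_∣) (s≗t k∈)))

T-isSignedDerangement : {n : ℕ} (i : ℕ) (σ : Vec ℤ n)
  → T (isDerangementB σ ∧ negSetIs i σ) ⇔ IsSignedDerangement n i σ⟨ σ ⟩
T-isSignedDerangement {n} i σ = mk⇔ to-der from-der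
  where
  s = σ⟨ σ ⟩
  into? = λ k → any (λ v → ⌊ s k ℤ.≟ v ⌋) ±[ n ]
  injective? = λ k l → ⌊ k ≟ l ⌋ ∨ not ⌊ ∣ s k ∣ ≟ ∣ s l ∣ ⌋
  unfixed? = λ k → not ⌊ s k ℤ.≟ + k ⌋
  negative? = λ k → not ⌊ s k ℤ.<? + 0 ⌋ ∨ any (λ v → ⌊ s k ℤ.≟ v ⌋) (negTarget n i)
  target? = λ v → any (λ k → ⌊ s k ℤ.≟ v ⌋ ∧ ⌊ s k ℤ.<? + 0 ⌋) [ n ]
  negative⇔ : ∀ k → T (negative? k) ⇔ (s k ℤ.< + 0 → s k ∈ negTarget n i)
  negative⇔ k = mk⇔ (λ h neg → to (T-any-≟ ℤ._≟_ _ _) (to (T-not-∨ (_ ℤ.<? _) _) h neg))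
                    (λ h → from (T-not-∨ (_ ℤ.<? _) _) (from (T-any-≟ ℤ._≟_ _ _) ∘ h))
  target⇔ : ∀ v → T (target? v) ⇔ (∃ λ k → k ∈ [ n ] × s k ≡ v × s k ℤ.< + 0)
  target⇔ v = mk⇔
    (λ h → let k , k∈ , eq∧neg = to (T-any _ [ n ]) h
               eq , neg = to (T-∧ {⌊ s k ℤ.≟ v ⌋}) eq∧neg
           in k , k∈ , toWitness eq , toWitness neg)
    (λ (k , k∈ , eq , neg) →
      from (T-any _ [ n ]) (k , k∈ , from (T-∧ {⌊ s k ℤ.≟ v ⌋}) (fromWitness eq , fromWitness neg)))
  to-der : T (isDerangementB σ ∧ negSetIs i σ) → IsSignedDerangement n i s
  to-der h =
    let der , neg = to T-∧ h
        perm , unfixed = to T-∧ der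
        into-b , inj-b = to T-∧ perm
        negative-b , target-b = to T-∧ neg
    in
    record
      { into             = λ k∈ → to (T-any-≟ ℤ._≟_ _ ±[ n ]) (T-all⁻ into? [ n ] into-b k∈)
      ; ∣∣-injective     = λ k∈ l∈ eq →
          toWitness (to (T-∨-not (_ ≟ _) _) (T-all⁻ _ [ n ] (T-all⁻ _ [ n ] inj-b k∈) l∈) eq)
      ; no-fixed-point   = λ k∈ → toWitnessFalse (T-all⁻ unfixed? [ n ] unfixed k∈)
      ; negative⇒target = λ {k} k∈ → to (negative⇔ k) (T-all⁻ negative? [ n ] negative-b k∈)
      ; target⇒negative = λ {v} v∈ → to (target⇔ v) (T-all⁻ target? (negTarget n i) target-b v∈)
      }
  from-der : IsSignedDerangement n i s → T (isDerangementB σ ∧ negSetIs i σ)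
  from-der d = from T-∧
    ( from T-∧ ( from T-∧ ( T-all⁺ into? [ n ] (λ k∈ → from (T-any-≟ ℤ._≟_ _ ±[ n ]) (into k∈))
                          , T-all⁺ _ [ n ] (λ k∈ → T-all⁺ _ [ n ] (λ l∈ →
                              from (T-∨-not (_ ≟ _) _) (fromWitness ∘ ∣∣-injective k∈ l∈))) )
               , T-all⁺ unfixed? [ n ] (fromWitnessFalse ∘ no-fixed-point) )
    , from T-∧ ( T-all⁺ negative? [ n ] (λ {k} k∈ → from (negative⇔ k) (negative⇒target k∈))
               , T-all⁺ target? (negTarget n i) (λ {v} v∈ → from (target⇔ v) (target⇒negative v∈)) ) )
    where open IsSignedDerangement d

opaque
  isSignedDerangementWithExc : {n : ℕ} → ℕ → ℕ → Vec ℤ n → Bool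
  isSignedDerangementWithExc i e σ = (isDerangementB σ ∧ negSetIs i σ) ∧ ⌊ excB σ ≟ e ⌋

  dBCoeff-suc : ∀ n i e → dBCoeff n (suc i) e ≡ count (isSignedDerangementWithExc (suc i) e) (vecsOver ±[ n ] n)
  dBCoeff-suc n i e = count-cong (vecsOver ±[ n ] n) λ {σ} _ →
    sym (∧-assoc (isDerangementB σ) (negSetIs (suc i) σ) ⌊ excB σ ≟ e ⌋)

  T-isSignedDerangementWithExc : {n : ℕ} (i e : ℕ) (σ : Vec ℤ n) {s : ℕ → ℤ} → σ⟨ σ ⟩ ≗[ n ] s
    → T (isSignedDerangementWithExc i e σ) ⇔ (IsSignedDerangement n i s × excBᶠ n s ≡ e)
  T-isSignedDerangementWithExc i e σ σ≗s = mk⇔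
    (λ h → let d , ex = to T-∧ h ; d′ = to (T-isSignedDerangement i σ) d in
      IsSignedDerangement-≗ σ≗s d′ , trans (sym (excBᶠ-≗ d′ σ≗s)) (toWitness ex))
    (λ (d , ex) → let d′ = IsSignedDerangement-≗ (sym ∘ σ≗s) d in
      from T-∧ (from (T-isSignedDerangement i σ) d′ , fromWitness (trans (excBᶠ-≗ d′ σ≗s) ex)))

module SignedRelabelling (n i : ℕ) (i≤n : i ≤ n) where

  -- signed v is the entry of absolute value v, negative exactly when v > m; rank v is its
  -- position in the order  -n < ⋯ < -(m+1) < 1 < ⋯ < m.
  m : ℕ
  m = n ∸ i

  rank : ℕ → ℕ
  rank v with v ≤? m
  ... | yes _ = v + i
  ... | no  _ = suc n ∸ v

  unrank : ℕ → ℕ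
  unrank j with j ≤? i
  ... | yes _ = suc n ∸ j
  ... | no  _ = j ∸ i

  signed : ℕ → ℤ
  signed v with v ≤? m
  ... | yes _ = + v
  ... | no  _ = - (+ v)

  rank-≤ : ∀ {v} → v ≤ m → rank v ≡ v + i
  rank-≤ {v} v≤m with v ≤? m
  ... | yes _   = refl
  ... | no  v≰m = ⊥-elim (v≰m v≤m)

  rank-> : ∀ {v} → m < v → rank v ≡ suc n ∸ v
  rank-> {v} m<v with v ≤? m
  ... | yes v≤m = ⊥-elim (<⇒≱ m<v v≤m)
  ... | no  _   = refl

  unrank-≤ : ∀ {j} → j ≤ i → unrank j ≡ suc n ∸ j
  unrank-≤ {j} j≤i with j ≤? i
  ... | yes _   = refl
  ... | no  j≰i = ⊥-elim (j≰i j≤i)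

  unrank-> : ∀ {j} → i < j → unrank j ≡ j ∸ i
  unrank-> {j} i<j with j ≤? i
  ... | yes j≤i = ⊥-elim (<⇒≱ i<j j≤i)
  ... | no  _   = refl

  signed-≤ : ∀ {v} → v ≤ m → signed v ≡ + v
  signed-≤ {v} v≤m with v ≤? m
  ... | yes _   = refl
  ... | no  v≰m = ⊥-elim (v≰m v≤m)

  signed-> : ∀ {v} → m < v → signed v ≡ - (+ v)
  signed-> {v} m<v with v ≤? m
  ... | yes v≤m = ⊥-elim (<⇒≱ m<v v≤m)
  ... | no  _   = refl

  ∣signed∣ : ∀ v → ∣ signed v ∣ ≡ v
  ∣signed∣ v with v ≤? m
  ... | yes _ = refl
  ... | no  _ = ℤ.∣-i∣≡∣i∣ (+ v)

  m+i≡n : m + i ≡ n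
  m+i≡n = m∸n+n≡m i≤n

  1+n∸v≤i : ∀ {v} → m < v → suc n ∸ v ≤ i
  1+n∸v≤i m<v = subst (_ ≤_) (m∸[m∸n]≡n i≤n) (∸-monoʳ-≤ (suc n) m<v)

  m<1+n∸j : ∀ {j} → j ≤ i → m < suc n ∸ j
  m<1+n∸j {j} j≤i = subst (_≤ suc n ∸ j) (+-∸-assoc 1 i≤n) (∸-monoʳ-≤ (suc n) j≤i)

  1+n∸-∈ : ∀ {v} → v ∈ [ n ] → suc n ∸ v ∈ [ n ]
  1+n∸-∈ v∈ = let 1≤v , v≤n = ∈[]⁻ v∈ in ∈[]⁺ (m<n⇒0<n∸m (s≤s v≤n)) (∸-monoʳ-≤ (suc n) 1≤v)

  1+n∸-involutive : ∀ {v} → v ∈ [ n ] → suc n ∸ (suc n ∸ v) ≡ v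
  1+n∸-involutive v∈ = m∸[m∸n]≡n (m≤n⇒m≤1+n (proj₂ (∈[]⁻ v∈)))

  rank-∈ : ∀ {v} → v ∈ [ n ] → rank v ∈ [ n ]
  rank-∈ {v} v∈ with v ≤? m
  ... | yes v≤m = let 1≤v , _ = ∈[]⁻ v∈ in
                  ∈[]⁺ (≤-trans 1≤v (m≤m+n v i)) (subst (_ ≤_) m+i≡n (+-monoˡ-≤ i v≤m))
  ... | no  _   = 1+n∸-∈ v∈

  unrank-∈ : ∀ {j} → j ∈ [ n ] → unrank j ∈ [ n ]
  unrank-∈ {j} j∈ with j ≤? i
  ... | yes _   = 1+n∸-∈ j∈
  ... | no  j≰i = let _ , j≤n = ∈[]⁻ j∈ in
                  ∈[]⁺ (m<n⇒0<n∸m (≰⇒> j≰i)) (≤-trans (∸-monoˡ-≤ i j≤n) (m∸n≤m n i))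

  unrank-rank : ∀ {v} → v ∈ [ n ] → unrank (rank v) ≡ v
  unrank-rank {v} v∈ with v ≤? m
  ... | yes v≤m = trans (unrank-> (+-monoˡ-≤ i (proj₁ (∈[]⁻ v∈)))) (m+n∸n≡m v i)
  ... | no  v≰m = trans (unrank-≤ (1+n∸v≤i (≰⇒> v≰m))) (1+n∸-involutive v∈)

  rank-unrank : ∀ {j} → j ∈ [ n ] → rank (unrank j) ≡ j
  rank-unrank {j} j∈ with j ≤? i
  ... | yes j≤i = trans (rank-> (m<1+n∸j j≤i)) (1+n∸-involutive j∈)
  ... | no  j≰i = trans (rank-≤ (∸-monoˡ-≤ i (proj₂ (∈[]⁻ j∈)))) (m∸n+n≡m (<⇒≤ (≰⇒> j≰i)))

  rank-injective : ∀ {v w} → v ∈ [ n ] → w ∈ [ n ] → rank v ≡ rank w → v ≡ w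
  rank-injective v∈ w∈ eq = trans (sym (unrank-rank v∈)) (trans (cong unrank eq) (unrank-rank w∈))

  unrank-injective : ∀ {j k} → j ∈ [ n ] → k ∈ [ n ] → unrank j ≡ unrank k → j ≡ k
  unrank-injective j∈ k∈ eq = trans (sym (rank-unrank j∈)) (trans (cong rank eq) (rank-unrank k∈))

  signed-<-rank : ∀ {v w} → v ∈ [ n ] → w ∈ [ n ] → (signed v ℤ.< signed w) ⇔ (rank v < rank w)
  signed-<-rank {zero} v∈ _ with () , _ ← ∈[]⁻ v∈
  signed-<-rank {_} {zero} _ w∈ with () , _ ← ∈[]⁻ w∈
  signed-<-rank {suc v} {suc w} v∈ w∈ with suc v ≤? m | suc w ≤? m
  ... | yes _   | yes _   = mk⇔
    (λ v<w → +-monoˡ-< i (ℤ.drop‿+<+ v<w)) (λ v+i<w+i → +<+ (+-cancelʳ-< i (suc v) (suc w) v+i<w+i))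
  ... | yes _   | no  w≰m = mk⇔
    (λ ()) (λ v+i<1+n∸w → ⊥-elim (<⇒≱ v+i<1+n∸w (≤-trans (1+n∸v≤i (≰⇒> w≰m)) (m≤n+m i (suc v)))))
  ... | no  v≰m | yes _   = mk⇔
    (λ _ → ≤-trans (s≤s (1+n∸v≤i (≰⇒> v≰m))) (+-monoˡ-≤ i (s≤s z≤n))) (λ _ → -<+)
  ... | no  _   | no  _   = mk⇔
    (λ v<w → ∸-monoʳ-< (s≤s (ℤ.drop‿-<- v<w)) (m≤n⇒m≤1+n (proj₂ (∈[]⁻ v∈))))
    (λ 1+n∸v<1+n∸w → -<- (≤-pred (∸-cancelʳ-< {o = suc n} 1+n∸v<1+n∸w)))

  signed-∈±[] : ∀ {v} → v ∈ [ n ] → signed v ∈ ±[ n ]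
  signed-∈±[] {v} v∈ with v ≤? m
  ... | yes _ = proj₁ (∈±[]⁺ v∈)
  ... | no  _ = proj₂ (∈±[]⁺ v∈)

  -w<0 : ∀ {w} → w ∈ [ n ] → - (+ w) ℤ.< + 0
  -w<0 {suc w} _  = -<+
  -w<0 {zero}  w∈ with () , _ ← ∈[]⁻ w∈

  +≮0 : ∀ {w} → ¬ (+ w ℤ.< + 0)
  +≮0 (+<+ ())

  signed-negative⁻ : ∀ {v} → signed v ℤ.< + 0 → m < v
  signed-negative⁻ {v} neg with v ≤? m
  ... | no  v≰m = ≰⇒> v≰m
  ... | yes _ = ⊥-elim (+≮0 neg)

  signed-negative⁺ : ∀ {v} → v ∈ [ n ] → m < v → signed v ℤ.< + 0
  signed-negative⁺ v∈ m<v = subst (ℤ._< + 0) (sym (signed-> m<v)) (-w<0 v∈)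

  ∈-negTarget⁺ : ∀ {w} → m < w → w ≤ n → - (+ w) ∈ negTarget n i
  ∈-negTarget⁺ {w} m<w w≤n = subst (_∈ negTarget n i) (cong (λ x → - (+ x)) (m∸[m∸n]≡n w≤n))
    (∈-map⁺ (λ t → - (+ (n ∸ t))) (∈-upTo⁺ (subst (n ∸ w <_) (m∸[m∸n]≡n i≤n) (∸-monoʳ-< m<w w≤n))))

  ∈-negTarget⁻ : ∀ {v} → v ∈ negTarget n i → ∃ λ w → m < w × w ≤ n × v ≡ - (+ w)
  ∈-negTarget⁻ v∈ with t , t∈ , refl ← ∈-map⁻ (λ t → - (+ (n ∸ t))) v∈ =
    n ∸ t , ∸-monoʳ-< (∈-upTo⁻ t∈) i≤n , m∸n≤m n t , refl

  toPerm : (ℕ → ℤ) → ℕ → ℕ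
  toPerm s = rank ∘ ∣_∣ ∘ s ∘ unrank

  fromPerm : (ℕ → ℕ) → ℕ → ℤ
  fromPerm t = signed ∘ unrank ∘ t ∘ rank

  module _ {s : ℕ → ℤ} (d : IsSignedDerangement n i s) where
    open IsSignedDerangement d

    -- the prescribed set of negative entries forces the sign of every entry
    signed-∣∣ : ∀ {k} → k ∈ [ n ] → s k ≡ signed ∣ s k ∣
    signed-∣∣ {k} k∈ with ∈±[]⁻ (into k∈)
    ... | w , w∈ , inj₂ sk≡-w =
      let w′ , m<w′ , _ , sk≡-w′ = ∈-negTarget⁻ (negative⇒target k∈ (subst (ℤ._< + 0) (sym sk≡-w) (-w<0 w∈))) in
      trans sk≡-w′ (sym (trans (cong (signed ∘ ∣_∣) sk≡-w′)
                               (trans (cong signed (ℤ.∣-i∣≡∣i∣ (+ w′))) (signed-> m<w′))))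
    ... | w , w∈ , inj₁ sk≡+w with w ≤? m
    ...   | yes w≤m = trans sk≡+w (sym (trans (cong (signed ∘ ∣_∣) sk≡+w) (signed-≤ w≤m)))
    ...   | no  w≰m =
      let l , l∈ , sl≡-w , _ = target⇒negative (∈-negTarget⁺ (≰⇒> w≰m) (proj₂ (∈[]⁻ w∈)))
          l≡k = ∣∣-injective l∈ k∈
                  (trans (cong ∣_∣ sl≡-w) (trans (ℤ.∣-i∣≡∣i∣ (+ w)) (cong ∣_∣ (sym sk≡+w))))
      in ⊥-elim (+≮0 (subst (ℤ._< + 0) (trans (sym sl≡-w) (trans (cong s l≡k) sk≡+w)) (-w<0 w∈)))

    toPerm-isDerangementAbove : IsDerangementAbove n i (toPerm s)
    toPerm-isDerangementAbove = record
      { isPermutation = record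
        { into      = λ j∈ → rank-∈ (∣∣-into (unrank-∈ j∈))
        ; injective = λ j∈ k∈ eq → unrank-injective j∈ k∈
            (∣∣-injective (unrank-∈ j∈) (unrank-∈ k∈)
              (rank-injective (∣∣-into (unrank-∈ j∈)) (∣∣-into (unrank-∈ k∈)) eq))
        }
      ; fixed≤ = fixed≤
      }
      where
      fixed≤ : NoFixedPointAbove n i (toPerm s)
      fixed≤ {j} j∈ fixes-j = ≮⇒≥ λ i<j →
        let u∈ = unrank-∈ j∈
            u≤m = subst (_≤ m) (sym (unrank-> i<j)) (∸-monoˡ-≤ i (proj₂ (∈[]⁻ j∈)))
            ∣su∣≡u = trans (sym (unrank-rank (∣∣-into u∈))) (cong unrank fixes-j)
        in no-fixed-point u∈ (trans (signed-∣∣ u∈) (trans (cong signed ∣su∣≡u) (signed-≤ u≤m)))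

    excᶠ-toPerm : excᶠ n (toPerm s) ≡ excBᶠ n s
    excᶠ-toPerm = begin
      count (λ j → ⌊ j <? toPerm s j ⌋) [ n ]
        ≡⟨ count-reindex n (λ j → ⌊ j <? toPerm s j ⌋) (rank ∘ ∣_∣ ∘ s) (rank-∈ ∘ ∣∣-into)
             (λ k∈ l∈ eq → ∣∣-injective k∈ l∈ (rank-injective (∣∣-into k∈) (∣∣-into l∈) eq)) ⟨
      count (λ k → ⌊ rank ∣ s k ∣ <? toPerm s (rank ∣ s k ∣) ⌋) [ n ]
        ≡⟨ count-cong [ n ] (λ {k} k∈ → trans
             (cong (λ u → ⌊ rank ∣ s k ∣ <? rank ∣ s u ∣ ⌋) (unrank-rank (∣∣-into k∈)))
             (sym (⌊⌋-cong-⇔ (_ ℤ.<? _) (_ <? _) (signed-<-rank (∣∣-into k∈) (∣∣-into (∣∣-into k∈)))))) ⟩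
      count (λ k → ⌊ signed ∣ s k ∣ ℤ.<? signed ∣ s ∣ s k ∣ ∣ ⌋) [ n ]
        ≡⟨ count-cong [ n ] (λ k∈ →
             sym (cong₂ (λ x y → ⌊ x ℤ.<? y ⌋) (signed-∣∣ k∈) (signed-∣∣ (∣∣-into k∈)))) ⟩
      count (λ k → ⌊ s k ℤ.<? s ∣ s k ∣ ⌋) [ n ] ∎
      where open ≡-Reasoning

    fromPerm-toPerm : fromPerm (toPerm s) ≗[ n ] s
    fromPerm-toPerm {k} k∈ = begin
      signed (unrank (rank ∣ s (unrank (rank k)) ∣))
        ≡⟨ cong (λ u → signed (unrank (rank ∣ s u ∣))) (unrank-rank k∈) ⟩
      signed (unrank (rank ∣ s k ∣))
        ≡⟨ cong signed (unrank-rank (∣∣-into k∈)) ⟩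
      signed ∣ s k ∣
        ≡⟨ signed-∣∣ k∈ ⟨
      s k ∎
      where open ≡-Reasoning

  toPerm-≗ : ∀ {s s′} → s ≗[ n ] s′ → toPerm s ≗[ n ] toPerm s′
  toPerm-≗ s≗s′ j∈ = cong (rank ∘ ∣_∣) (s≗s′ (unrank-∈ j∈))

  fromPerm-≗ : ∀ {t t′} → t ≗[ n ] t′ → fromPerm t ≗[ n ] fromPerm t′
  fromPerm-≗ t≗t′ k∈ = cong (signed ∘ unrank) (t≗t′ (rank-∈ k∈))

  module _ {t : ℕ → ℕ} (d : IsDerangementAbove n i t) where
    open IsDerangementAbove d

    fromPerm-isSignedDerangement : IsSignedDerangement n i (fromPerm t)
    fromPerm-isSignedDerangement = record
      { into             = λ k∈ → signed-∈±[] (unrank-into k∈)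
      ; ∣∣-injective     = λ {k} {l} k∈ l∈ eq → rank-injective k∈ l∈ (injective (rank-∈ k∈) (rank-∈ l∈)
          (unrank-injective (into (rank-∈ k∈)) (into (rank-∈ l∈))
            (trans (sym (∣signed∣ _)) (trans eq (∣signed∣ _)))))
      ; no-fixed-point   = no-fixed-point
      ; negative⇒target = λ k∈ neg → let m<u = signed-negative⁻ neg in
          subst (_∈ negTarget n i) (sym (signed-> m<u)) (∈-negTarget⁺ m<u (proj₂ (∈[]⁻ (unrank-into k∈))))
      ; target⇒negative = target⇒negative
      }
      where
      unrank-into : ∀ {k} → k ∈ [ n ] → unrank (t (rank k)) ∈ [ n ]
      unrank-into k∈ = unrank-∈ (into (rank-∈ k∈))
      no-fixed-point : ∀ {k} → k ∈ [ n ] → fromPerm t k ≢ + k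
      no-fixed-point {k} k∈ eq =
        let u≡k = trans (sym (∣signed∣ _)) (cong ∣_∣ eq)
            k≤m = ≮⇒≥ λ m<k →
              +≮0 (subst (ℤ._< + 0) eq (signed-negative⁺ (unrank-into k∈) (subst (m <_) (sym u≡k) m<k)))
            fixes-rank-k = trans (sym (rank-unrank (into (rank-∈ k∈)))) (cong rank u≡k)
        in <⇒≱ (subst (i <_) (sym (rank-≤ k≤m)) (+-monoˡ-≤ i (proj₁ (∈[]⁻ k∈))))
               (fixed≤ (rank-∈ k∈) fixes-rank-k)
      target⇒negative : ∀ {v} → v ∈ negTarget n i → ∃ λ k → k ∈ [ n ] × fromPerm t k ≡ v × fromPerm t k ℤ.< + 0
      target⇒negative v∈ =
        let w , m<w , w≤n , v≡-w = ∈-negTarget⁻ v∈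
            w∈ = ∈[]⁺ (≤-trans (s≤s z≤n) m<w) w≤n
            x , x∈ , tx≡rw = surjective (rank-∈ w∈)
            value = begin
              signed (unrank (t (rank (unrank x)))) ≡⟨ cong (signed ∘ unrank ∘ t) (rank-unrank x∈) ⟩
              signed (unrank (t x))                 ≡⟨ cong (signed ∘ unrank) tx≡rw ⟩
              signed (unrank (rank w))              ≡⟨ cong signed (unrank-rank w∈) ⟩
              signed w                              ≡⟨ signed-> m<w ⟩
              - (+ w)                               ≡⟨ v≡-w ⟨
              _                                     ∎
        in unrank x , unrank-∈ x∈ , value , subst (ℤ._< + 0) (sym (trans value v≡-w)) (-w<0 w∈)
        where open ≡-Reasoning

    toPerm-fromPerm : toPerm (fromPerm t) ≗[ n ] t
    toPerm-fromPerm {j} j∈ = begin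
      rank ∣ signed (unrank (t (rank (unrank j)))) ∣ ≡⟨ cong rank (∣signed∣ (unrank (t (rank (unrank j))))) ⟩
      rank (unrank (t (rank (unrank j))))           ≡⟨ rank-unrank (into (rank-∈ (unrank-∈ j∈))) ⟩
      t (rank (unrank j))                           ≡⟨ cong t (rank-unrank j∈) ⟩
      t j                                           ∎
      where open ≡-Reasoning

    excBᶠ-fromPerm : excBᶠ n (fromPerm t) ≡ excᶠ n t
    excBᶠ-fromPerm = trans (sym (excᶠ-toPerm fromPerm-isSignedDerangement)) (excᶠ-≗ toPerm-fromPerm)

  count-isSignedDerangementWithExc : ∀ e → count (isSignedDerangementWithExc i e) (vecsOver ±[ n ] n) ≡ dCoeffAbove n i e
  count-isSignedDerangementWithExc e = count-vecsOver-≡ (+ 0) 0 ±[ n ] [ n ] (Unique-±[] n) (Unique-[] n)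
    (isSignedDerangementWithExc i e) (isDerangementAboveWithExc i e) toPerm fromPerm
    (λ {σ} h → let d , ex = to (T-isSignedDerangementWithExc i e σ (λ _ → refl)) h in
      IsDerangementAbove.into (toPerm-isDerangementAbove d) ,
      from (T-isDerangementAboveWithExc i e _ (at-build 0 n (toPerm σ⟨ σ ⟩)))
           (toPerm-isDerangementAbove d , trans (excᶠ-toPerm d) ex))
    (λ {π} h → let d , ex = to (T-isDerangementAboveWithExc i e π (λ _ → refl)) h in
      IsSignedDerangement.into (fromPerm-isSignedDerangement d) ,
      from (T-isSignedDerangementWithExc i e _ (at-build (+ 0) n (fromPerm π⟨ π ⟩)))
           (fromPerm-isSignedDerangement d , trans (excBᶠ-fromPerm d) ex))
    (λ {σ} h → fromPerm-toPerm (proj₁ (to (T-isSignedDerangementWithExc i e σ (λ _ → refl)) h)))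
    (λ {π} h → toPerm-fromPerm (proj₁ (to (T-isDerangementAboveWithExc i e π (λ _ → refl)) h)))
    toPerm-≗ fromPerm-≗

dBCoeff≡dCoeffAbove : ∀ {n i} e → i ≤ n → dBCoeff n i e ≡ dCoeffAbove n i e
dBCoeff≡dCoeffAbove {n} {zero}  e _   = sym (dCoeffAbove-zero n e)
dBCoeff≡dCoeffAbove {n} {suc i} e i<n =
  trans (dBCoeff-suc n i e) (SignedRelabelling.count-isSignedDerangementWithExc n (suc i) i<n e)

mainTheorem1 : (n i : ℕ) → 1 ≤ n → 1 ≤ i → i ≤ n → (e : ℕ)
    → dBCoeff n i e ≡ dBCoeff n (i ∸ 1) e + dBCoeff (n ∸ 1) (i ∸ 1) e
mainTheorem1 (suc n) (suc i) _ _ i<1+n e = begin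
  dBCoeff (suc n) (suc i) e                    ≡⟨ dBCoeff≡dCoeffAbove e i<1+n ⟩
  dCoeffAbove (suc n) (suc i) e                ≡⟨ FixedPointInsertion.dCoeffAbove-suc i n i<1+n e ⟩
  dCoeffAbove (suc n) i e + dCoeffAbove n i e  ≡⟨ cong₂ _+_ (dBCoeff≡dCoeffAbove e (<⇒≤ i<1+n))
                                                            (dBCoeff≡dCoeffAbove e (≤-pred i<1+n)) ⟨
  dBCoeff (suc n) i e + dBCoeff n i e          ∎
  where open ≡-Reasoning
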